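{- The proof system $\mathbf{K}^\boxdot$ is sound and strongly complete with respect to the class of serial bimodal frames: for every set $\Gamma\subseteq\mathcal{L}(\boxdot)$ and $\phi\in\mathcal{L}(\boxdot)$, $\Gamma\vdash_{\mathbf{K}^\boxdot}\phi$ iff for every serial bimodal model $\mathcal{M}$ and point $s$, if $\mathcal{M},s\vDash\Gamma$ then $\mathcal{M},s\vDash\phi$.
   Context: Fix a nonempty set $\mathbf{P}$ of propositional variables; $\mathcal{L}(\boxdot)$ is given by $\phi::=p\mid\neg\phi\mid(\phi\land\phi)\mid\boxdot\phi$, $p\in\mathbf{P}$. A bimodal model is $\langle S,R_1,R_2,V\rangle$ with $S$ nonempty, $R_1,R_2\subseteq S\times S$, $V:\mathbf{P}\to\mathcal{P}(S)$; a frame omits $V$; it is serial if both $R_1$ and $R_2$ are serial. $\mathcal{M},s\vDash\boxdot\phi$ iff for all $t,u$ with $sR_1t$ and $sR_2u$, $(\mathcal{M},t\vDash\phi\iff\mathcal{M},u\vDash\phi)$; Boolean clauses as usual. $\mathbf{K}^\boxdot$ has axioms: all propositional tautologies; $\boxdot\top$; $\boxdot\phi\leftrightarrow\boxdot\neg\phi$; $\boxdot\phi\land\boxdot\psi\to\boxdot(\phi\land\psi)$; $\boxdot\phi\to\boxdot(\phi\vee\psi)\vee\boxdot(\neg\phi\vee\chi)$; rules: modus ponens and from $\phi\leftrightarrow\psi$ infer $\boxdot\phi\leftrightarrow\boxdot\psi$. $\Gamma\vdash\phi$ means $\vdash\gamma_1\land\dots\land\gamma_n\to\phi$ for some finitely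 many $\gamma_i\in\Gamma$. -}

module Defs where

open import Level using (Level; _⊔_; Setω) renaming (suc to lsuc; zero to lzero)
open import Data.Bool using (Bool; true; false; not; _∧_)
open import Data.Product using (Σ; ∃; _×_; _,_)
open import Data.Sum using (_⊎_)
open import Data.List using (List; []; _∷_; foldr)
open import Data.List.Relation.Unary.All using (All)
open import Relation.Nullary using (¬_)
open import Relation.Binary.PropositionalEquality using (_≡_)
open import Function.Bundles using (_⇔_)
open import Axiom.ExcludedMiddle using (ExcludedMiddle)

data Form (P : Set) : Set where
  var : P → Form P
  ~_  : Form P → Form P
  _∧'_ : Form P → Form P → Form P
  ⊡_  : Form P → Form P

infixr 6 _∧'_
infix 7 ~_ ⊡_

module _ {P : Set} where
  infixr 5 _∨'_
  infixr 4 _⇒_ _⇔'_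

  _∨'_ : Form P → Form P → Form P
  φ ∨' ψ = ~ (~ φ ∧' ~ ψ)

  _⇒_ : Form P → Form P → Form P
  φ ⇒ ψ = ~ (φ ∧' ~ ψ)

  _⇔'_ : Form P → Form P → Form P
  φ ⇔' ψ = (φ ⇒ ψ) ∧' (ψ ⇒ φ)

  ⊤' : P → Form P
  ⊤' p₀ = ~ (var p₀ ∧' ~ var p₀)

  evalB : (Form P → Bool) → Form P → Bool
  evalB v (var p) = v (var p)
  evalB v (~ φ) = not (evalB v φ)
  evalB v (φ ∧' ψ) = evalB v φ ∧ evalB v ψ
  evalB v (⊡ φ) = v (⊡ φ)

  -- propositional tautologies (instances in the full language)
  Tautology : Form P → Set
  Tautology φ = ∀ (v : Form P → Bool) → evalB v φ ≡ true

data Thm {P : Set} (p₀ : P) : Form P → Set where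
  taut   : ∀ {φ} → Tautology φ → Thm p₀ φ
  ax-top : Thm p₀ (⊡ ⊤' p₀)
  ax-neg : ∀ {φ} → Thm p₀ (⊡ φ ⇔' ⊡ (~ φ))
  ax-and : ∀ {φ ψ} → Thm p₀ ((⊡ φ ∧' ⊡ ψ) ⇒ ⊡ (φ ∧' ψ))
  ax-dis : ∀ {φ ψ χ} → Thm p₀ (⊡ φ ⇒ (⊡ (φ ∨' ψ) ∨' ⊡ (~ φ ∨' χ)))
  mp     : ∀ {φ ψ} → Thm p₀ (φ ⇒ ψ) → Thm p₀ φ → Thm p₀ ψ
  re     : ∀ {φ ψ} → Thm p₀ (φ ⇔' ψ) → Thm p₀ (⊡ φ ⇔' ⊡ ψ)

⋀ : {P : Set} → P → List (Form P) → Form P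
⋀ p₀ = foldr _∧'_ (⊤' p₀)

Derives : {P : Set} → P → (Form P → Set) → Form P → Set
Derives p₀ Γ φ = Σ (List _) λ γs → All Γ γs × Thm p₀ (⋀ p₀ γs ⇒ φ)

record Model (P : Set) (ℓ : Level) : Set (lsuc ℓ) where
  field
    S  : Set ℓ
    R₁ : S → S → Set ℓ
    R₂ : S → S → Set ℓ
    V  : P → S → Set ℓ

module _ {P : Set} {ℓ : Level} where
  open Model

  Serial : Model P ℓ → Set ℓ
  Serial M = (∀ s → ∃ λ t → R₁ M s t) × (∀ s → ∃ λ u → R₂ M s u)

  Sat : (M : Model P ℓ) → S M → Form P → Set ℓ
  Sat M s (var p) = V M p s
  Sat M s (~ φ) = ¬ Sat M s φ
  Sat M s (φ ∧' ψ) = Sat M s φ × Sat M s ψ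
  Sat M s (⊡ φ) = ∀ t u → R₁ M s t → R₂ M s u → (Sat M t φ ⇔ Sat M u φ)

Entails : {P : Set} (ℓ : Level) → (Form P → Set) → Form P → Set (lsuc ℓ)
Entails {P} ℓ Γ φ =
  (M : Model P ℓ) → Serial M → (s : Model.S M) →
  (∀ γ → Γ γ → Sat M s γ) → Sat M s φ

-- Classical metatheory (the paper's ambient ZFC), as hypotheses

LEM : Setω
LEM = ∀ ℓ → ExcludedMiddle ℓ

Zorn : Setω
Zorn = ∀ {a r c} (A : Set a) (_≤_ : A → A → Set r) →
  (∀ {x} → x ≤ x) → (∀ {x y z} → x ≤ y → y ≤ z → x ≤ z) →
  ((C : A → Set c) → (∀ {x y} → C x → C y → (x ≤ y) ⊎ (y ≤ x)) →
     ∃ λ u → ∀ {x} → C x → x ≤ u) →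
  ∃ λ m → ∀ y → m ≤ y → y ≤ m

module Submission where

-- Soundness is a direct check of the axioms; only the last one needs seriality, to compare
-- all successors of a point with one fixed successor.
--
-- Completeness is a canonical model argument. At a maximal consistent set s, call φ boxed
-- when ⊡(φ ∨ ψ) ∈ s for every ψ; boxed formulas play the role of the □-formulas of s.
-- Either every ⊡ψ lies in s (s is degenerate), or the boxed formulas form a consistent set,
-- and then ⊡φ ∈ s holds exactly when φ or ¬φ is boxed. Both canonical relations send a
-- degenerate s to itself and any other s to all maximal consistent extensions of its boxed
-- formulas, which gives a serial model with the truth lemma. Lindenbaum's lemma comes from
-- Zorn's lemma; excluded middle makes the semantics and the set comprehensions classical.

open import Defs
open import Level using (Level; Lift; lift; lower) renaming (zero to lzero)
open import Function.Base using (_∘_)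
open import Function.Bundles using (_⇔_; mk⇔; Equivalence)
open import Function.Construct.Composition using (_⇔-∘_)
open import Function.Construct.Symmetry using (⇔-sym)
open import Data.Bool using (Bool; true; false; not; _∧_; T; T?)
open import Data.Bool.Properties using (T-∧)
open import Data.Unit using (tt)
open import Data.Empty using (⊥-elim)
open import Data.Nat using (ℕ; zero; suc)
open import Data.Product using (∃; _×_; _,_; proj₁; proj₂)
open import Data.Sum using (_⊎_; inj₁; inj₂; fromInj₁; fromInj₂)
open import Data.List using (List; []; _∷_; _++_)
open import Data.List.Relation.Unary.All using (All; []; _∷_) renaming (map to All-map)
open import Data.List.Relation.Unary.All.Properties using (++⁺)
open import Relation.Nullary using (¬_; Dec; yes; no)
open import Relation.Nullary.Decidable using (isYes; toWitness; fromWitness; decidable-stable)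
open import Relation.Nullary.Reflects using (Reflects; invert; ¬-reflects; _×-reflects_)
open import Relation.Unary using (Pred; _⊆_; _∪_; ｛_｝)
open import Relation.Binary.PropositionalEquality using (_≡_; refl; subst)
open import Axiom.ExcludedMiddle using (ExcludedMiddle)

open Equivalence using (to; from)

infixr 5 _∨ᵇ_
infixr 4 _⇒ᵇ_ _⇔ᵇ_

-- evalB of the abbreviations in Defs computes to these, so a tautology instance of a
-- schema in n metavariables is a truth table of an n-ary Boolean function.
_⇒ᵇ_ _∨ᵇ_ _⇔ᵇ_ : Bool → Bool → Bool
x ⇒ᵇ y = not (x ∧ not y)
x ∨ᵇ y = not (not x ∧ not y)
x ⇔ᵇ y = (x ⇒ᵇ y) ∧ (y ⇒ᵇ x)

⊤ᵇ : Bool → Bool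
⊤ᵇ x = not (x ∧ not x)

BoolFn : ℕ → Set
BoolFn zero = Bool
BoolFn (suc n) = Bool → BoolFn n

allTrue : ∀ n → BoolFn n → Bool
allTrue zero b = b
allTrue (suc n) f = allTrue n (f true) ∧ allTrue n (f false)

AlwaysTrue : ∀ n → BoolFn n → Set
AlwaysTrue zero b = b ≡ true
AlwaysTrue (suc n) f = ∀ x → AlwaysTrue n (f x)

truthTable : ∀ n (f : BoolFn n) → T (allTrue n f) → AlwaysTrue n f
truthTable zero true _ = refl
truthTable (suc n) f h true = truthTable n (f true) (proj₁ (to (T-∧ {allTrue n (f true)}) h))
truthTable (suc n) f h false = truthTable n (f false) (proj₂ (to (T-∧ {allTrue n (f true)}) h))

module Soundness {P : Set} (p₀ : P) {ℓ : Level} (lem : ExcludedMiddle ℓ)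
                 (M : Model P ℓ) (serial : Serial M) where
  open Model M

  infix 4 _⊨_

  _⊨_ : S → Form P → Set ℓ
  s ⊨ φ = Sat M s φ

  private variable
    s : S
    φ ψ : Form P

  ⊨-⇒ : ∀ φ ψ → s ⊨ (φ ⇒ ψ) ⇔ (s ⊨ φ → s ⊨ ψ)
  ⊨-⇒ φ ψ = mk⇔ (λ h a → decidable-stable lem (λ ¬b → h (a , ¬b))) (λ f (a , ¬b) → ¬b (f a))

  ⊨-⇔′ : ∀ φ ψ → s ⊨ (φ ⇔' ψ) ⇔ (s ⊨ φ ⇔ s ⊨ ψ)
  ⊨-⇔′ φ ψ = mk⇔ (λ (a , b) → mk⇔ (to (⊨-⇒ φ ψ) a) (to (⊨-⇒ ψ φ) b))
                 (λ e → from (⊨-⇒ φ ψ) (to e) , from (⊨-⇒ ψ φ) (from e))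

  ⊨-⊤ : s ⊨ ⊤' p₀
  ⊨-⊤ (a , ¬a) = ¬a a

  ⊨-∨ˡ : ∀ φ ψ → s ⊨ φ → s ⊨ (φ ∨' ψ)
  ⊨-∨ˡ φ ψ a (¬a , _) = ¬a a

  ⊨-∨ʳ : ∀ φ ψ → s ⊨ ψ → s ⊨ (φ ∨' ψ)
  ⊨-∨ʳ φ ψ b (_ , ¬b) = ¬b b

  ⊨-⋀ : ∀ {γs} → All (s ⊨_) γs → s ⊨ ⋀ p₀ γs
  ⊨-⋀ [] = ⊨-⊤
  ⊨-⋀ (γ ∷ γs) = γ , ⊨-⋀ γs

  valuation : S → Form P → Bool
  valuation s φ = Dec.does (lem {s ⊨ φ})

  ⊨-reflects : ∀ s φ → Reflects (s ⊨ φ) (evalB (valuation s) φ)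
  ⊨-reflects s (var p) = Dec.proof lem
  ⊨-reflects s (~ φ) = ¬-reflects (⊨-reflects s φ)
  ⊨-reflects s (φ ∧' ψ) = ⊨-reflects s φ ×-reflects ⊨-reflects s ψ
  ⊨-reflects s (⊡ φ) = Dec.proof lem

  ⊨-tautology : ∀ φ → Tautology φ → s ⊨ φ
  ⊨-tautology {s} φ t = invert (subst (Reflects (s ⊨ φ)) (t (valuation s)) (⊨-reflects s φ))

  Uniform : S → Pred S ℓ → Set ℓ
  Uniform s A = (∀ {t} → R₁ s t → A t) × (∀ {u} → R₂ s u → A u)

  Uniform-map : {A B : Pred S ℓ} → (∀ {t} → A t → B t) → Uniform s A → Uniform s B
  Uniform-map f (all₁ , all₂) = f ∘ all₁ , f ∘ all₂

  ⊨-⊡-uniform : ∀ φ → Uniform s (_⊨ φ) → s ⊨ ⊡ φ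
  ⊨-⊡-uniform φ (all₁ , all₂) t u r₁ r₂ = mk⇔ (λ _ → all₂ r₂) (λ _ → all₁ r₁)

  ⊨-⊡-dichotomy : ∀ φ → s ⊨ ⊡ φ → Uniform s (_⊨ φ) ⊎ Uniform s (λ t → ¬ t ⊨ φ)
  ⊨-⊡-dichotomy {s} φ h with proj₁ serial s | proj₂ serial s
  ... | t₀ , r₀ | u₀ , q₀ with lem {t₀ ⊨ φ}
  ... | yes a = inj₁ ( (λ r₁ → from (h _ u₀ r₁ q₀) (to (h t₀ u₀ r₀ q₀) a))
                     , (λ r₂ → to (h t₀ _ r₀ r₂) a))
  ... | no ¬a = inj₂ ( (λ r₁ b → ¬a (from (h t₀ u₀ r₀ q₀) (to (h _ u₀ r₁ q₀) b)))
                     , (λ r₂ b → ¬a (from (h t₀ _ r₀ r₂) b)))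

  ⊨-⊡-split : ∀ φ ψ χ → s ⊨ ⊡ φ → s ⊨ (⊡ (φ ∨' ψ) ∨' ⊡ (~ φ ∨' χ))
  ⊨-⊡-split φ ψ χ h with ⊨-⊡-dichotomy φ h
  ... | inj₁ φ-everywhere =
    ⊨-∨ˡ (⊡ (φ ∨' ψ)) (⊡ (~ φ ∨' χ)) (⊨-⊡-uniform (φ ∨' ψ) (Uniform-map (⊨-∨ˡ φ ψ) φ-everywhere))
  ... | inj₂ ¬φ-everywhere =
    ⊨-∨ʳ (⊡ (φ ∨' ψ)) (⊡ (~ φ ∨' χ))
      (⊨-⊡-uniform (~ φ ∨' χ) (Uniform-map (⊨-∨ˡ (~ φ) χ) ¬φ-everywhere))

  ⊨-⊡-~ : ∀ φ → s ⊨ ⊡ φ ⇔ s ⊨ ⊡ (~ φ)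
  ⊨-⊡-~ φ = mk⇔
    (λ h t u r₁ r₂ → mk⇔ (λ ¬a b → ¬a (from (h t u r₁ r₂) b)) (λ ¬b a → ¬b (to (h t u r₁ r₂) a)))
    (λ h t u r₁ r₂ → mk⇔ (λ a → decidable-stable lem (λ ¬b → from (h t u r₁ r₂) ¬b a))
                         (λ b → decidable-stable lem (λ ¬a → to (h t u r₁ r₂) ¬a b)))

  ⊨-⊡-∧ : ∀ φ ψ → s ⊨ ⊡ φ → s ⊨ ⊡ ψ → s ⊨ ⊡ (φ ∧' ψ)
  ⊨-⊡-∧ φ ψ hφ hψ t u r₁ r₂ =
    mk⇔ (λ (a , b) → to (hφ t u r₁ r₂) a , to (hψ t u r₁ r₂) b)
        (λ (a , b) → from (hφ t u r₁ r₂) a , from (hψ t u r₁ r₂) b)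

  ⊨-⊡-cong : ∀ φ ψ → (∀ {t} → t ⊨ φ ⇔ t ⊨ ψ) → s ⊨ ⊡ φ → s ⊨ ⊡ ψ
  ⊨-⊡-cong φ ψ e h t u r₁ r₂ = e ⇔-∘ (h t u r₁ r₂ ⇔-∘ ⇔-sym e)

  valid : Thm p₀ φ → s ⊨ φ
  valid (taut {φ} t) = ⊨-tautology φ t
  valid ax-top = ⊨-⊡-uniform (⊤' p₀) ((λ _ → ⊨-⊤) , (λ _ → ⊨-⊤))
  valid (ax-neg {φ}) = from (⊨-⇔′ (⊡ φ) (⊡ (~ φ))) (⊨-⊡-~ φ)
  valid (ax-and {φ} {ψ}) = from (⊨-⇒ (⊡ φ ∧' ⊡ ψ) (⊡ (φ ∧' ψ))) λ (a , b) → ⊨-⊡-∧ φ ψ a b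
  valid (ax-dis {φ} {ψ} {χ}) = from (⊨-⇒ (⊡ φ) (⊡ (φ ∨' ψ) ∨' ⊡ (~ φ ∨' χ))) (⊨-⊡-split φ ψ χ)
  valid (mp {φ} {ψ} d e) = to (⊨-⇒ φ ψ) (valid d) (valid e)
  valid (re {φ} {ψ} d) =
    from (⊨-⇔′ (⊡ φ) (⊡ ψ)) (mk⇔ (⊨-⊡-cong φ ψ φ⇔ψ) (⊨-⊡-cong ψ φ (⇔-sym φ⇔ψ)))
    where
    φ⇔ψ : ∀ {t} → t ⊨ φ ⇔ t ⊨ ψ
    φ⇔ψ = to (⊨-⇔′ φ ψ) (valid d)

soundness : ∀ {P} (p₀ : P) {ℓ} → ExcludedMiddle ℓ →
            ∀ {Γ φ} → Derives p₀ Γ φ → Entails ℓ Γ φ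
soundness p₀ lem {φ = φ} (γs , γs⊆Γ , ⊢γs⇒φ) M serial s s⊨Γ =
  to (⊨-⇒ (⋀ p₀ γs) φ) (valid ⊢γs⇒φ) (⊨-⋀ (All-map (s⊨Γ _) γs⊆Γ))
  where open Soundness p₀ lem M serial

module Completeness {P : Set} (p₀ : P) where

  infix 3 ⊢_

  ⊢_ : Form P → Set
  ⊢_ = Thm p₀

  private variable
    a : Level
    φ ψ χ α : Form P
    γs δs : List (Form P)

  Consistent : Pred (Form P) a → Set a
  Consistent Δ = ∀ {γs} → All Δ γs → ¬ ⊢ ~ ⋀ p₀ γs

  mp-taut : Tautology (φ ⇒ ψ) → ⊢ φ → ⊢ ψ
  mp-taut t = mp (taut t)

  mp-taut₂ : Tautology (φ ⇒ ψ ⇒ χ) → ⊢ φ → ⊢ ψ → ⊢ χ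
  mp-taut₂ t d e = mp (mp (taut t) d) e

  ⋀-remove : {Δ : Pred (Form P) a} (α : Form P) → All (Δ ∪ ｛ α ｝) γs →
             ∃ λ δs → All Δ δs × ⊢ ⋀ p₀ δs ∧' α ⇒ ⋀ p₀ γs
  ⋀-remove α [] = [] , [] , taut λ v →
    truthTable 2 (λ x a → x ∧ a ⇒ᵇ x) tt (evalB v (⊤' p₀)) (evalB v α)
  ⋀-remove {γs = γ ∷ γs} α (inj₁ γ∈Δ ∷ rest) with ⋀-remove α rest
  ... | δs , δs⊆Δ , d = γ ∷ δs , γ∈Δ ∷ δs⊆Δ , mp-taut (λ v →
    truthTable 4 (λ g e a c → (e ∧ a ⇒ᵇ c) ⇒ᵇ (g ∧ e) ∧ a ⇒ᵇ g ∧ c) tt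
      (evalB v γ) (evalB v (⋀ p₀ δs)) (evalB v α) (evalB v (⋀ p₀ γs))) d
  ⋀-remove {γs = _ ∷ γs} α (inj₂ refl ∷ rest) with ⋀-remove α rest
  ... | δs , δs⊆Δ , d = δs , δs⊆Δ , mp-taut (λ v →
    truthTable 3 (λ e a c → (e ∧ a ⇒ᵇ c) ⇒ᵇ e ∧ a ⇒ᵇ a ∧ c) tt
      (evalB v (⋀ p₀ δs)) (evalB v α) (evalB v (⋀ p₀ γs))) d

  ⋀-++ : ∀ γs δs → ⊢ ⋀ p₀ (γs ++ δs) ⇒ ⋀ p₀ γs ∧' ⋀ p₀ δs
  ⋀-++ [] δs = taut λ v →
    truthTable 2 (λ d x → d ⇒ᵇ ⊤ᵇ x ∧ d) tt (evalB v (⋀ p₀ δs)) (v (var p₀))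
  ⋀-++ (γ ∷ γs) δs = mp-taut (λ v →
    truthTable 4 (λ g z c d → (z ⇒ᵇ c ∧ d) ⇒ᵇ g ∧ z ⇒ᵇ (g ∧ c) ∧ d) tt
      (evalB v γ) (evalB v (⋀ p₀ (γs ++ δs))) (evalB v (⋀ p₀ γs)) (evalB v (⋀ p₀ δs)))
    (⋀-++ γs δs)

  insert-consistent : {Δ : Pred (Form P) a} (α : Form P) →
                      (∀ {δs} → All Δ δs → ¬ ⊢ ⋀ p₀ δs ⇒ ~ α) → Consistent (Δ ∪ ｛ α ｝)
  insert-consistent α refutes {γs} γs⊆Δα ⊢¬γs with ⋀-remove α γs⊆Δα
  ... | δs , δs⊆Δ , d = refutes δs⊆Δ (mp-taut₂ (λ v →
    truthTable 3 (λ e a c → (e ∧ a ⇒ᵇ c) ⇒ᵇ not c ⇒ᵇ e ⇒ᵇ not a) tt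
      (evalB v (⋀ p₀ δs)) (evalB v α) (evalB v (⋀ p₀ γs))) d ⊢¬γs)

  record MCS : Set where
    field
      member : Form P → Bool
      consistent : Consistent (T ∘ member)
      maximal : ∀ φ → T (member φ) ⊎ T (member (~ φ))

  infix 3.5 _∈_ _∉_

  _∈_ _∉_ : Form P → MCS → Set
  φ ∈ w = T (MCS.member w φ)
  φ ∉ w = ¬ (φ ∈ w)

  module _ (w : MCS) where
    open MCS w

    derivable-∈ : All (_∈ w) γs → ⊢ ⋀ p₀ γs ⇒ φ → φ ∈ w
    derivable-∈ {γs} {φ} γs∈w d with maximal φ
    ... | inj₁ φ∈w = φ∈w
    ... | inj₂ ¬φ∈w = ⊥-elim (consistent (¬φ∈w ∷ γs∈w) (mp-taut (λ v →
      truthTable 2 (λ g f → (g ⇒ᵇ f) ⇒ᵇ not (not f ∧ g)) tt (evalB v (⋀ p₀ γs)) (evalB v φ)) d))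

    theorem-∈ : ⊢ φ → φ ∈ w
    theorem-∈ {φ} d = derivable-∈ [] (mp-taut (λ v →
      truthTable 2 (λ f x → f ⇒ᵇ ⊤ᵇ x ⇒ᵇ f) tt (evalB v φ) (v (var p₀))) d)

    mp-∈ : φ ⇒ ψ ∈ w → φ ∈ w → ψ ∈ w
    mp-∈ {φ} {ψ} φ⇒ψ∈w φ∈w = derivable-∈ (φ⇒ψ∈w ∷ φ∈w ∷ []) (taut λ v →
      truthTable 3 (λ f g x → (f ⇒ᵇ g) ∧ f ∧ x ⇒ᵇ g) tt
        (evalB v φ) (evalB v ψ) (evalB v (⊤' p₀)))

    ~-∈ : ~ φ ∈ w ⇔ φ ∉ w
    ~-∈ {φ} = mk⇔
      (λ ¬φ∈w φ∈w → consistent (¬φ∈w ∷ φ∈w ∷ []) (taut λ v →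
        truthTable 2 (λ f x → not (not f ∧ f ∧ x)) tt (evalB v φ) (evalB v (⊤' p₀))))
      (λ φ∉w → fromInj₂ (⊥-elim ∘ φ∉w) (maximal φ))

    ∧-∈ : φ ∧' ψ ∈ w ⇔ (φ ∈ w × ψ ∈ w)
    ∧-∈ {φ} {ψ} = mk⇔
      (λ h → derivable-∈ (h ∷ []) (taut λ v → truthTable 3 (λ f g x → (f ∧ g) ∧ x ⇒ᵇ f) tt
                                                  (evalB v φ) (evalB v ψ) (evalB v (⊤' p₀)))
           , derivable-∈ (h ∷ []) (taut λ v → truthTable 3 (λ f g x → (f ∧ g) ∧ x ⇒ᵇ g) tt
                                                  (evalB v φ) (evalB v ψ) (evalB v (⊤' p₀))))
      (λ (φ∈w , ψ∈w) → derivable-∈ (φ∈w ∷ ψ∈w ∷ []) (taut λ v →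
        truthTable 3 (λ f g x → f ∧ g ∧ x ⇒ᵇ f ∧ g) tt
          (evalB v φ) (evalB v ψ) (evalB v (⊤' p₀))))

    ⇔-∈ : φ ⇔' ψ ∈ w → (φ ∈ w ⇔ ψ ∈ w)
    ⇔-∈ h = let (φ⇒ψ , ψ⇒φ) = to ∧-∈ h in mk⇔ (mp-∈ φ⇒ψ) (mp-∈ ψ⇒φ)

    ∨-∈ : φ ∨' ψ ∈ w → φ ∈ w ⊎ ψ ∈ w
    ∨-∈ {φ} {ψ} h with maximal φ | maximal ψ
    ... | inj₁ φ∈w | _ = inj₁ φ∈w
    ... | inj₂ _ | inj₁ ψ∈w = inj₂ ψ∈w
    ... | inj₂ ¬φ∈w | inj₂ ¬ψ∈w = ⊥-elim (to ~-∈ h (from ∧-∈ (¬φ∈w , ¬ψ∈w)))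

  module Lindenbaum (lem : ExcludedMiddle lzero) (zorn : Zorn)
                    {Δ : Pred (Form P) lzero} (Δ-consistent : Consistent Δ) where

    -- Subsets of formulas are Bool-valued, so that the union of a chain of them is again one
    -- at the same universe level.
    ⌊_⌋ : Set → Bool
    ⌊ A ⌋ = isYes (lem {A})

    record Candidate : Set where
      field
        member : Form P → Bool
        extends : Δ ⊆ T ∘ member
        consistent : Consistent (T ∘ member)
    open Candidate

    _≼_ : Candidate → Candidate → Set
    X ≼ Y = T ∘ member X ⊆ T ∘ member Y

    Chain : Pred Candidate lzero → Set
    Chain C = ∀ {X Y} → C X → C Y → X ≼ Y ⊎ Y ≼ X

    InChain : Pred Candidate lzero → Pred (Form P) lzero
    InChain C φ = ∃ λ X → C X × T (member X φ)

    All-chain : ∀ {C} → Chain C → All (Δ ∪ InChain C) γs →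
                All Δ γs ⊎ ∃ λ X → C X × All (T ∘ member X) γs
    All-chain chain [] = inj₁ []
    All-chain chain (h ∷ hs) with h | All-chain chain hs
    ... | inj₁ γ∈Δ | inj₁ γs⊆Δ = inj₁ (γ∈Δ ∷ γs⊆Δ)
    ... | inj₁ γ∈Δ | inj₂ (X , X∈C , γs⊆X) = inj₂ (X , X∈C , extends X γ∈Δ ∷ γs⊆X)
    ... | inj₂ (Y , Y∈C , γ∈Y) | inj₁ γs⊆Δ = inj₂ (Y , Y∈C , γ∈Y ∷ All-map (extends Y) γs⊆Δ)
    ... | inj₂ (Y , Y∈C , γ∈Y) | inj₂ (X , X∈C , γs⊆X) with chain X∈C Y∈C
    ...   | inj₁ X≼Y = inj₂ (Y , Y∈C , γ∈Y ∷ All-map X≼Y γs⊆X)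
    ...   | inj₂ Y≼X = inj₂ (X , X∈C , Y≼X γ∈Y ∷ γs⊆X)

    chain-bounded : ∀ C → Chain C → ∃ λ U → ∀ {X} → C X → X ≼ U
    chain-bounded C chain = U , λ X∈C φ∈X → fromWitness (inj₂ (_ , X∈C , φ∈X))
      where
      U-consistent : Consistent (T ∘ λ φ → ⌊ (Δ ∪ InChain C) φ ⌋)
      U-consistent γs⊆U with All-chain chain (All-map toWitness γs⊆U)
      ... | inj₁ γs⊆Δ = Δ-consistent γs⊆Δ
      ... | inj₂ (X , _ , γs⊆X) = consistent X γs⊆X
      U : Candidate
      U = record { member = λ φ → ⌊ (Δ ∪ InChain C) φ ⌋
                 ; extends = fromWitness ∘ inj₁
                 ; consistent = U-consistent }

    module Maximal (m : Candidate) (m-maximal : ∀ Y → m ≼ Y → Y ≼ m) where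

      insert-∈ : Consistent ((T ∘ member m) ∪ ｛ α ｝) → T (member m α)
      insert-∈ {α} cons = m-maximal m+α (fromWitness ∘ inj₁) (fromWitness (inj₂ refl))
        where
        m+α : Candidate
        m+α = record { member = λ φ → ⌊ ((T ∘ member m) ∪ ｛ α ｝) φ ⌋
                     ; extends = fromWitness ∘ inj₁ ∘ extends m
                     ; consistent = cons ∘ All-map toWitness }

      refuted-∉ : ¬ T (member m α) → ∃ λ δs → All (T ∘ member m) δs × ⊢ ⋀ p₀ δs ⇒ ~ α
      refuted-∉ {α} α∉m with lem {∃ λ δs → All (T ∘ member m) δs × ⊢ ⋀ p₀ δs ⇒ ~ α}
      ... | yes refutation = refutation
      ... | no ¬refutation =
        ⊥-elim (α∉m (insert-∈ (insert-consistent α λ δs⊆m d → ¬refutation (_ , δs⊆m , d))))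

      m-complete : ∀ φ → T (member m φ) ⊎ T (member m (~ φ))
      m-complete φ with T? (member m φ)
      ... | yes φ∈m = inj₁ φ∈m
      ... | no φ∉m = inj₂ (insert-∈ (insert-consistent (~ φ) λ {δs} δs⊆m d →
        let (γs , γs⊆m , e) = refuted-∉ φ∉m in
        consistent m (++⁺ γs⊆m δs⊆m) (mp (mp-taut₂ (λ v →
          truthTable 4
            (λ c d f z → (c ⇒ᵇ not f) ⇒ᵇ (d ⇒ᵇ not (not f)) ⇒ᵇ (z ⇒ᵇ c ∧ d) ⇒ᵇ not z) tt
            (evalB v (⋀ p₀ γs)) (evalB v (⋀ p₀ δs)) (evalB v φ) (evalB v (⋀ p₀ (γs ++ δs))))
          e d) (⋀-++ γs δs))))

    lindenbaum : ∃ λ (w : MCS) → Δ ⊆ (_∈ w)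
    lindenbaum with zorn Candidate _≼_ (λ φ∈X → φ∈X) (λ X≼Y Y≼Z → Y≼Z ∘ X≼Y) chain-bounded
    ... | m , m-maximal = record { member = member m
                                 ; consistent = consistent m
                                 ; maximal = Maximal.m-complete m m-maximal }
                        , extends m

  module Canonical (lem : ExcludedMiddle lzero) (zorn : Zorn) where
    open MCS

    extend : {Δ : Pred (Form P) lzero} → Consistent Δ → ∃ λ (w : MCS) → Δ ⊆ (_∈ w)
    extend Δ-consistent = Lindenbaum.lindenbaum lem zorn Δ-consistent

    module _ (s : MCS) where

      Boxed : Pred (Form P) lzero
      Boxed φ = ∀ ψ → ⊡ (φ ∨' ψ) ∈ s

      Degenerate : Set
      Degenerate = ∀ ψ → ⊡ ψ ∈ s

      ⊡-cong-∈ : ⊢ φ ⇔' ψ → ⊡ φ ∈ s → ⊡ ψ ∈ s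
      ⊡-cong-∈ d = to (⇔-∈ s (theorem-∈ s (re d)))

      ⊡-~-∈ : ⊡ φ ∈ s ⇔ ⊡ (~ φ) ∈ s
      ⊡-~-∈ = ⇔-∈ s (theorem-∈ s ax-neg)

      Boxed-mono : Boxed φ → ⊢ φ ⇒ ψ → Boxed ψ
      Boxed-mono {φ} {ψ} φ-boxed d χ = ⊡-cong-∈ (mp-taut (λ v →
        truthTable 3 (λ f g c → (f ⇒ᵇ g) ⇒ᵇ (f ∨ᵇ g ∨ᵇ c ⇔ᵇ g ∨ᵇ c)) tt
          (evalB v φ) (evalB v ψ) (evalB v χ)) d) (φ-boxed (ψ ∨' χ))

      Boxed-∧ : Boxed φ → Boxed ψ → Boxed (φ ∧' ψ)
      Boxed-∧ {φ} {ψ} φ-boxed ψ-boxed χ = ⊡-cong-∈ (taut λ v →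
        truthTable 3 (λ f g c → (f ∨ᵇ c) ∧ (g ∨ᵇ c) ⇔ᵇ f ∧ g ∨ᵇ c) tt
          (evalB v φ) (evalB v ψ) (evalB v χ))
        (mp-∈ s (theorem-∈ s ax-and) (from (∧-∈ s) (φ-boxed χ , ψ-boxed χ)))

      Boxed-⋀ : All Boxed γs → Boxed (⋀ p₀ γs)
      Boxed-⋀ [] χ = ⊡-cong-∈ (taut λ v →
        truthTable 2 (λ x c → ⊤ᵇ x ⇔ᵇ ⊤ᵇ x ∨ᵇ c) tt (v (var p₀)) (evalB v χ)) (theorem-∈ s ax-top)
      Boxed-⋀ (γ-boxed ∷ γs-boxed) = Boxed-∧ γ-boxed (Boxed-⋀ γs-boxed)

      Boxed⇒⊡ : Boxed φ → ⊡ φ ∈ s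
      Boxed⇒⊡ {φ} φ-boxed = ⊡-cong-∈ (taut λ v →
        truthTable 1 (λ f → f ∨ᵇ f ⇔ᵇ f) tt (evalB v φ)) (φ-boxed φ)

      Boxed-consistent : ¬ Degenerate → Consistent Boxed
      Boxed-consistent nondegenerate {γs} γs-boxed ⊢¬γs = nondegenerate λ ψ →
        Boxed⇒⊡ (Boxed-mono (Boxed-⋀ γs-boxed) (mp-taut (λ v →
          truthTable 2 (λ g f → not g ⇒ᵇ g ⇒ᵇ f) tt (evalB v (⋀ p₀ γs)) (evalB v ψ)) ⊢¬γs))

      insert-Boxed-consistent : ¬ Boxed (~ α) → Consistent (Boxed ∪ ｛ α ｝)
      insert-Boxed-consistent α-unrefuted =
        insert-consistent _ λ δs-boxed d → α-unrefuted (Boxed-mono (Boxed-⋀ δs-boxed) d)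

      ⊡-∈-dichotomy : ⊡ φ ∈ s → Boxed φ ⊎ Boxed (~ φ)
      ⊡-∈-dichotomy {φ} ⊡φ∈s with lem {Boxed φ}
      ... | yes φ-boxed = inj₁ φ-boxed
      ... | no φ-unboxed = inj₂ ¬φ-boxed
        where
        ¬φ-boxed : Boxed (~ φ)
        ¬φ-boxed χ with T? (member s (⊡ (~ φ ∨' χ)))
        ... | yes ⊡¬φχ∈s = ⊡¬φχ∈s
        ... | no ⊡¬φχ∉s = ⊥-elim (φ-unboxed λ ψ → fromInj₁ (⊥-elim ∘ ⊡¬φχ∉s)
          (∨-∈ s (mp-∈ s (theorem-∈ s (ax-dis {φ = φ} {ψ} {χ})) ⊡φ∈s)))

    -- A degenerate point only needs some successor, and every successor of it must agree on
    -- all formulas: it is made to see itself alone.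
    _⟶_ : MCS → MCS → Set
    s ⟶ t = (Degenerate s × t ≡ s) ⊎ (¬ Degenerate s × Boxed s ⊆ (_∈ t))

    ⟶-serial : ∀ s → ∃ (s ⟶_)
    ⟶-serial s with lem {Degenerate s}
    ... | yes degenerate = s , inj₁ (degenerate , refl)
    ... | no nondegenerate with extend (Boxed-consistent s nondegenerate)
    ...   | t , boxed⊆t = t , inj₂ (nondegenerate , boxed⊆t)

    ⊡-∈-agree : ∀ {s t u} → ⊡ φ ∈ s → s ⟶ t → s ⟶ u → φ ∈ t ⇔ φ ∈ u
    ⊡-∈-agree _ (inj₁ (_ , refl)) (inj₁ (_ , refl)) = mk⇔ (λ φ∈s → φ∈s) (λ φ∈s → φ∈s)
    ⊡-∈-agree _ (inj₁ (degenerate , _)) (inj₂ (nondegenerate , _)) =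
      ⊥-elim (nondegenerate degenerate)
    ⊡-∈-agree _ (inj₂ (nondegenerate , _)) (inj₁ (degenerate , _)) =
      ⊥-elim (nondegenerate degenerate)
    ⊡-∈-agree {φ} {s} {t} {u} ⊡φ∈s (inj₂ (_ , boxed⊆t)) (inj₂ (_ , boxed⊆u))
      with ⊡-∈-dichotomy s ⊡φ∈s
    ... | inj₁ φ-boxed = mk⇔ (λ _ → boxed⊆u φ-boxed) (λ _ → boxed⊆t φ-boxed)
    ... | inj₂ ¬φ-boxed =
      mk⇔ (λ φ∈t → ⊥-elim (to (~-∈ t) (boxed⊆t ¬φ-boxed) φ∈t))
          (λ φ∈u → ⊥-elim (to (~-∈ u) (boxed⊆u ¬φ-boxed) φ∈u))

    ⊡-∉-witnesses : ∀ {s} → ⊡ φ ∉ s → ∃ λ t → ∃ λ u → s ⟶ t × s ⟶ u × φ ∈ t × ~ φ ∈ u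
    ⊡-∉-witnesses {φ} {s} ⊡φ∉s
      with extend (insert-Boxed-consistent s λ ¬φ-boxed →
             ⊡φ∉s (from (⊡-~-∈ s) (Boxed⇒⊡ s ¬φ-boxed)))
         | extend (insert-Boxed-consistent s λ ¬¬φ-boxed →
             ⊡φ∉s (from (⊡-~-∈ s) (from (⊡-~-∈ s) (Boxed⇒⊡ s ¬¬φ-boxed))))
    ... | t , boxed∪φ⊆t | u , boxed∪¬φ⊆u =
      t , u , inj₂ (nondegenerate , boxed∪φ⊆t ∘ inj₁) , inj₂ (nondegenerate , boxed∪¬φ⊆u ∘ inj₁) ,
      boxed∪φ⊆t (inj₂ refl) , boxed∪¬φ⊆u (inj₂ refl)
      where
      nondegenerate : ¬ Degenerate s
      nondegenerate degenerate = ⊡φ∉s (degenerate φ)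

    canonical : (ℓ : Level) → Model P ℓ
    canonical ℓ = record
      { S = Lift ℓ MCS
      ; R₁ = λ s t → Lift ℓ (lower s ⟶ lower t)
      ; R₂ = λ s t → Lift ℓ (lower s ⟶ lower t)
      ; V = λ p s → Lift ℓ (var p ∈ lower s)
      }

    canonical-serial : ∀ ℓ → Serial (canonical ℓ)
    canonical-serial ℓ = successor , successor
      where
      successor : ∀ s → ∃ (Model.R₁ (canonical ℓ) s)
      successor (lift s) = let (t , s⟶t) = ⟶-serial s in lift t , lift s⟶t

    truth : ∀ {ℓ} φ s → Sat (canonical ℓ) (lift s) φ ⇔ φ ∈ s
    truth (var p) s = mk⇔ lower lift
    truth (~ φ) s = mk⇔ (λ ⊭φ → from (~-∈ s) (⊭φ ∘ from (truth φ s)))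
                        (λ ¬φ∈s → to (~-∈ s) ¬φ∈s ∘ to (truth φ s))
    truth (φ ∧' ψ) s = mk⇔
      (λ (a , b) → from (∧-∈ s) (to (truth φ s) a , to (truth ψ s) b))
      (λ h → let (a , b) = to (∧-∈ s) h in from (truth φ s) a , from (truth ψ s) b)
    truth (⊡ φ) s = mk⇔ ⊨⊡φ⇒∈ ∈⇒⊨⊡φ
      where
      ⊨⊡φ⇒∈ : Sat (canonical _) (lift s) (⊡ φ) → ⊡ φ ∈ s
      ⊨⊡φ⇒∈ ⊨⊡φ with T? (member s (⊡ φ))
      ... | yes ⊡φ∈s = ⊡φ∈s
      ... | no ⊡φ∉s with ⊡-∉-witnesses ⊡φ∉s
      ...   | t , u , s⟶t , s⟶u , φ∈t , ¬φ∈u = ⊥-elim (to (~-∈ u) ¬φ∈u (to (truth φ u)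
        (to (⊨⊡φ (lift t) (lift u) (lift s⟶t) (lift s⟶u)) (from (truth φ t) φ∈t))))
      ∈⇒⊨⊡φ : ⊡ φ ∈ s → Sat (canonical _) (lift s) (⊡ φ)
      ∈⇒⊨⊡φ ⊡φ∈s (lift t) (lift u) (lift s⟶t) (lift s⟶u) =
        ⇔-sym (truth φ u) ⇔-∘ (⊡-∈-agree ⊡φ∈s s⟶t s⟶u ⇔-∘ truth φ t)

    underivable-consistent : ∀ {Γ φ} → ¬ Derives p₀ Γ φ → Consistent (Γ ∪ ｛ ~ φ ｝)
    underivable-consistent {φ = φ} Γ⊬φ = insert-consistent (~ φ) λ {δs} δs⊆Γ d →
      Γ⊬φ (δs , δs⊆Γ , mp-taut (λ v →
        truthTable 2 (λ e f → (e ⇒ᵇ not (not f)) ⇒ᵇ e ⇒ᵇ f) tt (evalB v (⋀ p₀ δs)) (evalB v φ)) d)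

    completeness : ∀ ℓ {Γ φ} → Entails ℓ Γ φ → Derives p₀ Γ φ
    completeness ℓ {Γ} {φ} Γ⊨φ with lem {Derives p₀ Γ φ}
    ... | yes Γ⊢φ = Γ⊢φ
    ... | no Γ⊬φ with extend (underivable-consistent Γ⊬φ)
    ...   | s , Γ∪¬φ⊆s = ⊥-elim (to (~-∈ s) (Γ∪¬φ⊆s (inj₂ refl)) (to (truth φ s) s⊨φ))
      where
      s⊨φ : Sat (canonical ℓ) (lift s) φ
      s⊨φ = Γ⊨φ (canonical ℓ) (canonical-serial ℓ) (lift s) λ γ γ∈Γ →
        from (truth γ s) (Γ∪¬φ⊆s (inj₁ γ∈Γ))

theorem7p15 : LEM → Zorn → (P : Set) (p₀ : P) (ℓ : Level)
    (Γ : Form P → Set) (φ : Form P) →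
    Derives p₀ Γ φ ⇔ Entails ℓ Γ φ
theorem7p15 lem zorn P p₀ ℓ Γ φ =
  mk⇔ (soundness p₀ (lem ℓ)) (Completeness.Canonical.completeness p₀ (lem lzero) zorn ℓ)
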